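{- The comparison atoms $\Pr(\alpha \mid \beta)\vartriangleleft \Pr(\gamma \mid \delta)$ and $\Pr(\alpha \mid \beta)\vartriangleleft \Pr(\gamma)$ (where $\vartriangleleft \in \{\leq,\geq,<,>,=\}$) are not, in general, expressible in $\mathcal{PCO}$.
   Context: Causal multiteams $T=(T^-,\mathcal F)$ of a finite signature consist of a finite multiset $T^-$ of assignments and a (recursive) function component $\mathcal F$ of structural equations. For a $\mathcal{CO}$ formula $\gamma$, $T^\gamma$ is the sub-multiteam of assignments satisfying $\gamma$, and $P_T(\alpha)$ is the proportion of assignments of $T^-$ satisfying $\alpha$. The conditional comparison atoms are interpreted by: $T\models\Pr(\alpha\mid\beta)\vartriangleleft\Pr(\gamma\mid\delta)$ iff $(T^\beta)^-=\emptyset$ or $(T^\delta)^-=\emptyset$ or $P_{T^\beta}(\alpha)\vartriangleleft P_{T^\delta}(\gamma)$; and $\Pr(\alpha\mid\beta)\vartriangleleft\Pr(\gamma)$ is the case $\delta=\top$. The language $\mathcal{PCO}$ is built from $\mathcal{CO}$ literals and unconditional probabilistic atoms $\Pr(\alpha)\geq\epsilon$, $\Pr(\alpha)>\epsilon$, $\Pr(\alpha)\geq\Pr(\beta)$, $\Pr(\alpha)>\Pr(\beta)$ ($\alpha,\beta\in\mathcal{CO}$, $\epsilon\in[0,1]\cap\mathbb Q$, true on empty multiteams), closed under $\land$, global disjunction $\sqcup$, selective implication $\alpha\supset\varphi$ and interventionist counterfactual $\mathbf X=\mathbf x\,\Box\!\!\rightarrow\varphi$. Expressibility means equivalence (same satisfying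 causal multiteams of the signature) with some $\mathcal{PCO}$ formula. -}

module Defs where

open import Data.Nat using (ℕ; zero; suc; _<_; _≤_)
open import Data.Fin using (Fin) renaming (_≟_ to _≟F_)
open import Data.Bool using (Bool; true; false; _∧_; _∨_; not; if_then_else_)
open import Data.Maybe using (Maybe; just; nothing; is-nothing)
open import Data.List using (List; []; _∷_; filterᵇ; length; map)
open import Data.List.Relation.Unary.All using (All)
open import Data.Product using (Σ; _×_; _,_)
open import Data.Sum using (_⊎_)
open import Relation.Binary.PropositionalEquality using (_≡_)
open import Relation.Nullary using (¬_)
open import Relation.Nullary.Decidable using (⌊_⌋)
open import Data.Integer using (+_)
open import Data.Rational using (ℚ; 0ℚ; 1ℚ; _/_) renaming (_≤_ to _≤ℚ_; _<_ to _<ℚ_)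

record Signature : Set where
  field
    size  : ℕ
    rng   : Fin size → ℕ
    rng≥2 : ∀ v → 2 ≤ rng v
open Signature public

iter : {A : Set} → ℕ → (A → A) → A → A
iter zero    f a = a
iter (suc k) f a = f (iter k f a)

-- the proportion k / m (0 when m = 0; only used when m ≠ 0)
prop : ℕ → ℕ → ℚ
prop k zero    = 0ℚ
prop k (suc m) = (+ k) / suc m

data Cmp : Set where
  le ge lt gt eq : Cmp

cmpℚ : Cmp → ℚ → ℚ → Set
cmpℚ le p q = p ≤ℚ q
cmpℚ ge p q = q ≤ℚ p
cmpℚ lt p q = p <ℚ q
cmpℚ gt p q = q <ℚ p
cmpℚ eq p q = p ≡ q

module _ (σ : Signature) where

  Var : Set
  Var = Fin (size σ)

  Val : Var → Set
  Val v = Fin (rng σ v)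

  Asg : Set
  Asg = (v : Var) → Val v

  -- an intervention X = x (X a set of distinct variables): partial assignment
  Intv : Set
  Intv = (v : Var) → Maybe (Val v)

  -- function component, without the well-formedness side conditions
  -- (these are imposed in CausalMultiteam below)
  record RawFC : Set where
    field
      endo : Var → Bool
      fn   : (v : Var) → Asg → Val v     -- F_v (reads only parents, see below)
  open RawFC public

  intF : RawFC → Intv → RawFC
  intF F I = record { endo = λ v → endo F v ∧ is-nothing (I v) ; fn = fn F }

  upd : RawFC → Intv → Asg → Asg
  upd F I t v with I v
  ... | just x  = x
  ... | nothing = if endo F v then fn F v t else t v

  -- s_{X=x}: the (unique, by recursivity) solution; size σ rounds suffice
  intA : RawFC → Intv → Asg → Asg
  intA F I s = iter (size σ) (upd F I) s

  data CO : Set where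
    eqᶜ neqᶜ : (v : Var) → Val v → CO
    _∧ᶜ_ _∨ᶜ_ _⊃ᶜ_ : CO → CO → CO
    _□→ᶜ_ : Intv → CO → CO

  -- CO is flat; satisfaction by the singleton causal team ({s},F)
  satCO : RawFC → Asg → CO → Bool
  satCO F s (eqᶜ v x)  = ⌊ s v ≟F x ⌋
  satCO F s (neqᶜ v x) = not ⌊ s v ≟F x ⌋
  satCO F s (α ∧ᶜ β)   = satCO F s α ∧ satCO F s β
  satCO F s (α ∨ᶜ β)   = satCO F s α ∨ satCO F s β
  satCO F s (α ⊃ᶜ β)   = not (satCO F s α) ∨ satCO F s β
  satCO F s (I □→ᶜ α)  = satCO (intF F I) (intA F I s) α

  restrict : RawFC → List Asg → CO → List Asg
  restrict F T α = filterᵇ (λ s → satCO F s α) T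

  Pr : RawFC → List Asg → CO → ℚ
  Pr F T α = prop (length (restrict F T α)) (length T)

  data PCO : Set where
    eqᵖ neqᵖ : (v : Var) → Val v → PCO
    prGe prGt : CO → (ε : ℚ) → 0ℚ ≤ℚ ε → ε ≤ℚ 1ℚ → PCO
    prGeP prGtP : CO → CO → PCO
    _∧ᵖ_ _⊔_ : PCO → PCO → PCO
    _⊃ᵖ_ : CO → PCO → PCO
    _□→ᵖ_ : Intv → PCO → PCO

  sat : RawFC → List Asg → PCO → Set
  sat F T (eqᵖ v x)       = All (λ s → s v ≡ x) T
  sat F T (neqᵖ v x)      = All (λ s → ¬ (s v ≡ x)) T
  sat F T (prGe α ε _ _)  = T ≡ [] ⊎ ε ≤ℚ Pr F T α
  sat F T (prGt α ε _ _)  = T ≡ [] ⊎ ε <ℚ Pr F T α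
  sat F T (prGeP α β)     = T ≡ [] ⊎ Pr F T β ≤ℚ Pr F T α
  sat F T (prGtP α β)     = T ≡ [] ⊎ Pr F T β <ℚ Pr F T α
  sat F T (φ ∧ᵖ ψ)        = sat F T φ × sat F T ψ
  sat F T (φ ⊔ ψ)         = sat F T φ ⊎ sat F T ψ
  sat F T (α ⊃ᵖ φ)        = sat F (restrict F T α) φ
  sat F T (I □→ᵖ φ)       = sat (intF F I) (map (intA F I) T) φ

  -- causal multiteams: multiset T^- (a list, up to order) and a recursive
  -- function component F whose equations are satisfied by every assignment
  record CausalMultiteam : Set where
    field
      F      : RawFC
      pa     : Var → Var → Bool        -- pa v w : w ∈ PA_v
      dep    : ∀ v (s t : Asg) → endo F v ≡ true →
               (∀ w → pa v w ≡ true → s w ≡ t w) → fn F v s ≡ fn F v t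
      rank   : Var → ℕ                 -- recursivity: acyclic causal graph
      acyc   : ∀ v w → endo F v ≡ true → pa v w ≡ true → rank w < rank v
      team   : List Asg
      compat : All (λ s → ∀ v → endo F v ≡ true → s v ≡ fn F v s) team
  open CausalMultiteam public

  CondAtom : Cmp → CO → CO → CO → CO → CausalMultiteam → Set
  CondAtom c α β γ δ T =
    restrict (F T) (team T) β ≡ [] ⊎ restrict (F T) (team T) δ ≡ [] ⊎
    cmpℚ c (Pr (F T) (restrict (F T) (team T) β) α)
           (Pr (F T) (restrict (F T) (team T) δ) γ)

  UncondAtom : Cmp → CO → CO → CO → CausalMultiteam → Set
  UncondAtom c α β γ T =
    restrict (F T) (team T) β ≡ [] ⊎ team T ≡ [] ⊎
    cmpℚ c (Pr (F T) (restrict (F T) (team T) β) α) (Pr (F T) (team T) γ)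

  ExpressiblePCO : (CausalMultiteam → Set) → Set
  ExpressiblePCO A = Σ PCO λ φ → ∀ T →
    (sat (F T) (team T) φ → A T) × (A T → sat (F T) (team T) φ)

-- Every atom of PCO is closed under unions of multiteams: a union adds the counts of the
-- two teams, and each probabilistic atom is a homogeneous linear inequality between counts
-- (the literals are flat). The connectives of PCO preserve the weaker property that the
-- satisfying multiteams fall into finitely many union-closed classes, so by pigeonhole a
-- PCO formula true on every member of an infinite sequence of multiteams is true on the
-- union of some two of them.
--
-- For one variable X with values 0, 1, 2, the atom Pr(X=0 | X≠2) ◁ Pr(X=1) compares two
-- quadratic forms in the counts and is not union-closed: on teams with one 0, b = 2, 4, 6, …
-- ones and b² − 2 + e twos it holds with = (e = 1) or with < (e = 0), while on the union of
-- two such teams the balance tips towards > by the square of the gap between their numbers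
-- of ones. The atoms with ≥ and > reduce to ≤ and < by complementing α and γ, and the
-- conditional atoms reduce to the unconditional ones by taking δ a tautology.

module Submission where

open import Defs
open import Data.Bool using (Bool; true; false; if_then_else_; T?)
open import Data.Bool.Properties using (∨-inverseʳ; T-≡)
open import Data.Empty using (⊥)
open import Data.Fin as Fin using (Fin; toℕ; combine; join; splitAt) renaming (_≟_ to _≟F_)
open import Data.Fin.Patterns using (0F; 1F; 2F)
import Data.Fin.Properties as Fin
open import Data.Integer as ℤ using (+_)
import Data.Integer.Properties as ℤ
open import Data.List using (List; []; _∷_; _++_; length; map; filterᵇ; replicate)
import Data.List.Properties as List
import Data.List.Relation.Unary.All as All
import Data.List.Relation.Unary.All.Properties as All
open import Data.Nat as ℕ using (ℕ; zero; suc; _+_; _*_; _<_; s≤s; z≤n)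
import Data.Nat.Properties as ℕ
open import Data.Nat.Tactic.RingSolver using (solve-∀)
open import Data.Product using (Σ; ∃; ∃₂; _×_; _,_; proj₁; proj₂)
open import Data.Rational as ℚ using (mkℚ; ↥_; ↧_; toℚᵘ) renaming (_≤_ to _≤ℚ_; _<_ to _<ℚ_)
import Data.Rational.Properties as ℚ
open import Data.Rational.Unnormalised as ℚᵘ using (mkℚᵘ; *≤*; *<*) renaming (_≃_ to _≃ᵘ_)
import Data.Rational.Unnormalised.Properties as ℚᵘ
open import Data.Sum using (_⊎_; inj₁; inj₂)
import Data.Sum.Properties as Sum
open import Function using (_∘_)
open import Function.Bundles using (_⇔_; mk⇔; Equivalence)
open import Function.Properties.Equivalence using () renaming (trans to ⇔-trans; sym to ⇔-sym)
open import Relation.Binary.PropositionalEquality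
open import Relation.Nullary using (¬_; contradiction)
open import Relation.Nullary.Decidable using (⌊_⌋)

-- Proportions

cmpℕ : Cmp → ℕ → ℕ → Set
cmpℕ le m n = m ℕ.≤ n
cmpℕ ge m n = n ℕ.≤ m
cmpℕ lt m n = m ℕ.< n
cmpℕ gt m n = n ℕ.< m
cmpℕ eq m n = m ≡ n

prop≃ : ∀ k m → toℚᵘ (prop k (suc m)) ≃ᵘ mkℚᵘ (+ k) m
prop≃ k m = ℚ.toℚᵘ-fromℚᵘ (mkℚᵘ (+ k) m)

≤-prop⇔ : ∀ p k m → (p ≤ℚ prop k (suc m)) ⇔ (↥ p ℤ.* + suc m ℤ.≤ + k ℤ.* ↧ p)
≤-prop⇔ p@(mkℚ _ _ _) k m = mk⇔ to from
  where
  to : p ≤ℚ prop k (suc m) → ↥ p ℤ.* + suc m ℤ.≤ + k ℤ.* ↧ p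
  to h with ℚᵘ.≤-respʳ-≃ (prop≃ k m) (ℚ.toℚᵘ-mono-≤ h)
  ... | *≤* h′ = h′
  from : ↥ p ℤ.* + suc m ℤ.≤ + k ℤ.* ↧ p → p ≤ℚ prop k (suc m)
  from h = ℚ.toℚᵘ-cancel-≤ (ℚᵘ.≤-respʳ-≃ (ℚᵘ.≃-sym (prop≃ k m)) (*≤* h))

<-prop⇔ : ∀ p k m → (p <ℚ prop k (suc m)) ⇔ (↥ p ℤ.* + suc m ℤ.< + k ℤ.* ↧ p)
<-prop⇔ p@(mkℚ _ _ _) k m = mk⇔ to from
  where
  to : p <ℚ prop k (suc m) → ↥ p ℤ.* + suc m ℤ.< + k ℤ.* ↧ p
  to h with ℚᵘ.<-respʳ-≃ (prop≃ k m) (ℚ.toℚᵘ-mono-< h)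
  ... | *<* h′ = h′
  from : ↥ p ℤ.* + suc m ℤ.< + k ℤ.* ↧ p → p <ℚ prop k (suc m)
  from h = ℚ.toℚᵘ-cancel-< (ℚᵘ.<-respʳ-≃ (ℚᵘ.≃-sym (prop≃ k m)) (*<* h))

prop-≤-prop⇔ : ∀ k m l n → (prop k (suc m) ≤ℚ prop l (suc n)) ⇔ (k * suc n ℕ.≤ l * suc m)
prop-≤-prop⇔ k m l n = mk⇔ to from
  where
  to : prop k (suc m) ≤ℚ prop l (suc n) → k * suc n ℕ.≤ l * suc m
  to h with ℚᵘ.≤-respˡ-≃ (prop≃ k m) (ℚᵘ.≤-respʳ-≃ (prop≃ l n) (ℚ.toℚᵘ-mono-≤ h))
  ... | *≤* h′ rewrite sym (ℤ.pos-* k (suc n)) | sym (ℤ.pos-* l (suc m)) = ℤ.drop‿+≤+ h′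
  from : k * suc n ℕ.≤ l * suc m → prop k (suc m) ≤ℚ prop l (suc n)
  from h = ℚ.toℚᵘ-cancel-≤ (ℚᵘ.≤-respˡ-≃ (ℚᵘ.≃-sym (prop≃ k m)) (ℚᵘ.≤-respʳ-≃ (ℚᵘ.≃-sym (prop≃ l n)) (*≤* h′)))
    where
    h′ : + k ℤ.* + suc n ℤ.≤ + l ℤ.* + suc m
    h′ = subst₂ ℤ._≤_ (ℤ.pos-* k (suc n)) (ℤ.pos-* l (suc m)) (ℤ.+≤+ h)

prop-<-prop⇔ : ∀ k m l n → (prop k (suc m) <ℚ prop l (suc n)) ⇔ (k * suc n ℕ.< l * suc m)
prop-<-prop⇔ k m l n = mk⇔ to from
  where
  to : prop k (suc m) <ℚ prop l (suc n) → k * suc n ℕ.< l * suc m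
  to h with ℚᵘ.<-respˡ-≃ (prop≃ k m) (ℚᵘ.<-respʳ-≃ (prop≃ l n) (ℚ.toℚᵘ-mono-< h))
  ... | *<* h′ rewrite sym (ℤ.pos-* k (suc n)) | sym (ℤ.pos-* l (suc m)) = ℤ.drop‿+<+ h′
  from : k * suc n ℕ.< l * suc m → prop k (suc m) <ℚ prop l (suc n)
  from h = ℚ.toℚᵘ-cancel-< (ℚᵘ.<-respˡ-≃ (ℚᵘ.≃-sym (prop≃ k m)) (ℚᵘ.<-respʳ-≃ (ℚᵘ.≃-sym (prop≃ l n)) (*<* h′)))
    where
    h′ : + k ℤ.* + suc n ℤ.< + l ℤ.* + suc m
    h′ = subst₂ ℤ._<_ (ℤ.pos-* k (suc n)) (ℤ.pos-* l (suc m)) (ℤ.+<+ h)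

prop-cmp-prop⇔ : ∀ c k m l n → cmpℚ c (prop k (suc m)) (prop l (suc n)) ⇔ cmpℕ c (k * suc n) (l * suc m)
prop-cmp-prop⇔ le k m l n = prop-≤-prop⇔ k m l n
prop-cmp-prop⇔ ge k m l n = prop-≤-prop⇔ l n k m
prop-cmp-prop⇔ lt k m l n = prop-<-prop⇔ k m l n
prop-cmp-prop⇔ gt k m l n = prop-<-prop⇔ l n k m
prop-cmp-prop⇔ eq k m l n = mk⇔
  (λ e → ℕ.≤-antisym (to (ℚ.≤-reflexive e)) (to′ (ℚ.≤-reflexive (sym e))))
  (λ e → ℚ.≤-antisym (from (ℕ.≤-reflexive e)) (from′ (ℕ.≤-reflexive (sym e))))
  where
  open Equivalence (prop-≤-prop⇔ k m l n)
  open Equivalence (prop-≤-prop⇔ l n k m) renaming (to to to′; from to from′)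

prop-≤⇔ : ∀ j k m → (prop j (suc m) ≤ℚ prop k (suc m)) ⇔ (j ℕ.≤ k)
prop-≤⇔ j k m = mk⇔ (λ h → ℕ.*-cancelʳ-≤ j k (suc m) (to h)) (λ h → from (ℕ.*-monoˡ-≤ (suc m) h))
  where open Equivalence (prop-≤-prop⇔ j m k m)

prop-<⇔ : ∀ j k m → (prop j (suc m) <ℚ prop k (suc m)) ⇔ (j ℕ.< k)
prop-<⇔ j k m = mk⇔ (λ h → ℕ.*-cancelʳ-< (suc m) j k (to h)) (λ h → from (ℕ.*-monoˡ-< (suc m) h))
  where open Equivalence (prop-<-prop⇔ j m k m)

≤-prop-+ : ∀ p k m l n → p ≤ℚ prop k (suc m) → p ≤ℚ prop l (suc n) → p ≤ℚ prop (k + l) (suc m + suc n)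
≤-prop-+ p k m l n h₁ h₂ = Equivalence.from (≤-prop⇔ p (k + l) (m + suc n)) sum
  where
  sum : ↥ p ℤ.* + (suc m + suc n) ℤ.≤ + (k + l) ℤ.* ↧ p
  sum rewrite ℤ.pos-+ (suc m) (suc n) | ℤ.pos-+ k l
            | ℤ.*-distribˡ-+ (↥ p) (+ suc m) (+ suc n) | ℤ.*-distribʳ-+ (↧ p) (+ k) (+ l)
            = ℤ.+-mono-≤ (Equivalence.to (≤-prop⇔ p k m) h₁) (Equivalence.to (≤-prop⇔ p l n) h₂)

<-prop-+ : ∀ p k m l n → p <ℚ prop k (suc m) → p <ℚ prop l (suc n) → p <ℚ prop (k + l) (suc m + suc n)
<-prop-+ p k m l n h₁ h₂ = Equivalence.from (<-prop⇔ p (k + l) (m + suc n)) sum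
  where
  sum : ↥ p ℤ.* + (suc m + suc n) ℤ.< + (k + l) ℤ.* ↧ p
  sum rewrite ℤ.pos-+ (suc m) (suc n) | ℤ.pos-+ k l
            | ℤ.*-distribˡ-+ (↥ p) (+ suc m) (+ suc n) | ℤ.*-distribʳ-+ (↧ p) (+ k) (+ l)
            = ℤ.+-mono-< (Equivalence.to (<-prop⇔ p k m) h₁) (Equivalence.to (<-prop⇔ p l n) h₂)

converse : Cmp → Cmp
converse le = ge
converse ge = le
converse lt = gt
converse gt = lt
converse eq = eq

≤-complement : ∀ {a b x y} → a + b ≡ x + y → a ℕ.≤ x → y ℕ.≤ b
≤-complement {a} {b} {x} {y} e a≤x = ℕ.+-cancelˡ-≤ a y b (subst (a + y ℕ.≤_) (sym e) (ℕ.+-monoˡ-≤ y a≤x))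

<-complement : ∀ {a b x y} → a + b ≡ x + y → a ℕ.< x → y ℕ.< b
<-complement {a} {b} {x} {y} e a<x = ℕ.+-cancelˡ-< a y b (subst (a + y ℕ.<_) (sym e) (ℕ.+-monoˡ-< y a<x))

swap-sum : ∀ a b x y → a + b ≡ x + y → y + x ≡ b + a
swap-sum a b x y e = trans (ℕ.+-comm y x) (trans (sym e) (ℕ.+-comm a b))

cmpℕ-converse : ∀ c {a b x y} → a + b ≡ x + y → cmpℕ c a x ⇔ cmpℕ (converse c) b y
cmpℕ-converse le {a} {b} {x} {y} e = mk⇔ (≤-complement e) (≤-complement (swap-sum a b x y e))
cmpℕ-converse ge {a} {b} {x} {y} e = mk⇔ (≤-complement (sym e)) (≤-complement (sym (swap-sum a b x y e)))
cmpℕ-converse lt {a} {b} {x} {y} e = mk⇔ (<-complement e) (<-complement (swap-sum a b x y e))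
cmpℕ-converse gt {a} {b} {x} {y} e = mk⇔ (<-complement (sym e)) (<-complement (sym (swap-sum a b x y e)))
cmpℕ-converse eq {a} {b} {x} {y} e = mk⇔
  (λ a≡x → ℕ.+-cancelˡ-≡ a b y (trans e (cong (_+ y) (sym a≡x))))
  (λ b≡y → ℕ.+-cancelʳ-≡ b a x (trans e (cong (λ z → x + z) (sym b≡y))))

*-sum-swap : ∀ k k′ l l′ {M N} → k + k′ ≡ M → l + l′ ≡ N → k * N + k′ * N ≡ l * M + l′ * M
*-sum-swap k k′ l l′ {M} {N} k+k′≡M l+l′≡N = begin
  k * N + k′ * N   ≡⟨ ℕ.*-distribʳ-+ N k k′ ⟨
  (k + k′) * N     ≡⟨ cong (_* N) k+k′≡M ⟩
  M * N            ≡⟨ ℕ.*-comm M N ⟩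
  N * M            ≡⟨ cong (_* M) l+l′≡N ⟨
  (l + l′) * M     ≡⟨ ℕ.*-distribʳ-+ M l l′ ⟩
  l * M + l′ * M   ∎
  where open ≡-Reasoning

-- PCO formulas and unions of multiteams

[]-or-length-suc : ∀ {A : Set} (xs : List A) → xs ≡ [] ⊎ ∃ λ m → length xs ≡ suc m
[]-or-length-suc []       = inj₁ refl
[]-or-length-suc (_ ∷ xs) = inj₂ (length xs , refl)

length-suc : ∀ {A : Set} (xs : List A) {m} → suc m ℕ.≤ length xs → ∃ λ n → length xs ≡ suc n
length-suc (_ ∷ xs) _ = length xs , refl

module _ {σ : Signature} where

  count : RawFC σ → List (Asg σ) → CO σ → ℕ
  count F T α = length (restrict σ F T α)

  restrict-++ : ∀ F (T₁ T₂ : List (Asg σ)) α →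
                restrict σ F (T₁ ++ T₂) α ≡ restrict σ F T₁ α ++ restrict σ F T₂ α
  restrict-++ F T₁ T₂ α = List.filter-++ (T? ∘ λ s → satCO σ F s α) T₁ T₂

  count-++ : ∀ F (T₁ T₂ : List (Asg σ)) α → count F (T₁ ++ T₂) α ≡ count F T₁ α + count F T₂ α
  count-++ F T₁ T₂ α = trans (cong length (restrict-++ F T₁ T₂ α)) (List.length-++ (restrict σ F T₁ α))

  Pr-++ : ∀ F (T₁ T₂ : List (Asg σ)) α →
          Pr σ F (T₁ ++ T₂) α ≡ prop (count F T₁ α + count F T₂ α) (length T₁ + length T₂)
  Pr-++ F T₁ T₂ α = cong₂ prop (count-++ F T₁ T₂ α) (List.length-++ T₁)

  count-eq+count-neq : ∀ F (T : List (Asg σ)) v x → count F T (eqᶜ v x) + count F T (neqᶜ v x) ≡ length T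
  count-eq+count-neq F []      v x = refl
  count-eq+count-neq F (s ∷ T) v x with satCO σ F s (eqᶜ v x)
  ... | true  = cong suc (count-eq+count-neq F T v x)
  ... | false = trans (ℕ.+-suc _ _) (cong suc (count-eq+count-neq F T v x))

  UnionClosed : PCO σ → Set
  UnionClosed φ = ∀ F T₁ T₂ → sat σ F T₁ φ → sat σ F T₂ φ → sat σ F (T₁ ++ T₂) φ

  ++-closed-on-nonempty : (P : List (Asg σ) → Set) →
    (∀ x xs y ys → P (x ∷ xs) → P (y ∷ ys) → P ((x ∷ xs) ++ (y ∷ ys))) →
    ∀ T₁ T₂ → T₁ ≡ [] ⊎ P T₁ → T₂ ≡ [] ⊎ P T₂ → T₁ ++ T₂ ≡ [] ⊎ P (T₁ ++ T₂)
  ++-closed-on-nonempty P step []       T₂       _        h₂       = h₂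
  ++-closed-on-nonempty P step (x ∷ xs) []       h₁       _        =
    subst (λ T → T ≡ [] ⊎ P T) (sym (List.++-identityʳ (x ∷ xs))) h₁
  ++-closed-on-nonempty P step (x ∷ xs) (y ∷ ys) (inj₂ p) (inj₂ q) = inj₂ (step x xs y ys p q)

  eqᵖ-unionClosed : ∀ v x → UnionClosed (eqᵖ v x)
  eqᵖ-unionClosed v x F T₁ T₂ = All.++⁺

  neqᵖ-unionClosed : ∀ v x → UnionClosed (neqᵖ v x)
  neqᵖ-unionClosed v x F T₁ T₂ = All.++⁺

  prGe-unionClosed : ∀ α ε 0≤ε ε≤1 → UnionClosed (prGe α ε 0≤ε ε≤1)
  prGe-unionClosed α ε _ _ F = ++-closed-on-nonempty (λ T → ε ≤ℚ Pr σ F T α)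
    λ x xs y ys p q → subst (ε ≤ℚ_) (sym (Pr-++ F (x ∷ xs) (y ∷ ys) α))
      (≤-prop-+ ε (count F (x ∷ xs) α) (length xs) (count F (y ∷ ys) α) (length ys) p q)

  prGt-unionClosed : ∀ α ε 0≤ε ε≤1 → UnionClosed (prGt α ε 0≤ε ε≤1)
  prGt-unionClosed α ε _ _ F = ++-closed-on-nonempty (λ T → ε <ℚ Pr σ F T α)
    λ x xs y ys p q → subst (ε <ℚ_) (sym (Pr-++ F (x ∷ xs) (y ∷ ys) α))
      (<-prop-+ ε (count F (x ∷ xs) α) (length xs) (count F (y ∷ ys) α) (length ys) p q)

  prGeP-unionClosed : ∀ α β → UnionClosed (prGeP α β)
  prGeP-unionClosed α β F = ++-closed-on-nonempty (λ T → Pr σ F T β ≤ℚ Pr σ F T α)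
    λ x xs y ys p q → subst₂ _≤ℚ_ (sym (Pr-++ F (x ∷ xs) (y ∷ ys) β)) (sym (Pr-++ F (x ∷ xs) (y ∷ ys) α))
      (from (prop-≤⇔ _ _ (length xs + suc (length ys)))
        (ℕ.+-mono-≤ (to (prop-≤⇔ (count F (x ∷ xs) β) (count F (x ∷ xs) α) (length xs)) p)
                     (to (prop-≤⇔ (count F (y ∷ ys) β) (count F (y ∷ ys) α) (length ys)) q)))
    where open Equivalence

  prGtP-unionClosed : ∀ α β → UnionClosed (prGtP α β)
  prGtP-unionClosed α β F = ++-closed-on-nonempty (λ T → Pr σ F T β <ℚ Pr σ F T α)
    λ x xs y ys p q → subst₂ _<ℚ_ (sym (Pr-++ F (x ∷ xs) (y ∷ ys) β)) (sym (Pr-++ F (x ∷ xs) (y ∷ ys) α))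
      (from (prop-<⇔ _ _ (length xs + suc (length ys)))
        (ℕ.+-mono-< (to (prop-<⇔ (count F (x ∷ xs) β) (count F (x ∷ xs) α) (length xs)) p)
                     (to (prop-<⇔ (count F (y ∷ ys) β) (count F (y ∷ ys) α) (length ys)) q)))
    where open Equivalence

  record UnionClasses (φ : PCO σ) : Set where
    field
      classes  : ℕ
      class    : ∀ F T → sat σ F T φ → Fin classes
      class-++ : ∀ F T₁ T₂ (h₁ : sat σ F T₁ φ) (h₂ : sat σ F T₂ φ) →
                 class F T₁ h₁ ≡ class F T₂ h₂ → sat σ F (T₁ ++ T₂) φ

  unionClosed⇒UnionClasses : ∀ {φ} → UnionClosed φ → UnionClasses φ
  unionClosed⇒UnionClasses closed = record
    { classes = 1 ; class = λ _ _ _ → Fin.zero ; class-++ = λ F T₁ T₂ h₁ h₂ _ → closed F T₁ T₂ h₁ h₂ }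

  join-injective : ∀ {m n} {i j : Fin m ⊎ Fin n} → join m n i ≡ join m n j → i ≡ j
  join-injective {m} {n} {i} {j} e =
    trans (sym (Fin.splitAt-join m n i)) (trans (cong (splitAt m) e) (Fin.splitAt-join m n j))

  unionClasses : ∀ φ → UnionClasses φ
  unionClasses (eqᵖ v x)          = unionClosed⇒UnionClasses (eqᵖ-unionClosed v x)
  unionClasses (neqᵖ v x)         = unionClosed⇒UnionClasses (neqᵖ-unionClosed v x)
  unionClasses (prGe α ε 0≤ε ε≤1) = unionClosed⇒UnionClasses (prGe-unionClosed α ε 0≤ε ε≤1)
  unionClasses (prGt α ε 0≤ε ε≤1) = unionClosed⇒UnionClasses (prGt-unionClosed α ε 0≤ε ε≤1)
  unionClasses (prGeP α β)        = unionClosed⇒UnionClasses (prGeP-unionClosed α β)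
  unionClasses (prGtP α β)        = unionClosed⇒UnionClasses (prGtP-unionClosed α β)
  unionClasses (φ ∧ᵖ ψ) = record
    { classes  = classes₁ * classes₂
    ; class    = λ F T h → combine (class₁ F T (proj₁ h)) (class₂ F T (proj₂ h))
    ; class-++ = λ F T₁ T₂ h₁ h₂ e →
        let (e₁ , e₂) = Fin.combine-injective _ _ _ _ e
        in class-++₁ F T₁ T₂ (proj₁ h₁) (proj₁ h₂) e₁ ,
           class-++₂ F T₁ T₂ (proj₂ h₁) (proj₂ h₂) e₂
    }
    where
    open UnionClasses (unionClasses φ) renaming (classes to classes₁; class to class₁; class-++ to class-++₁)
    open UnionClasses (unionClasses ψ) renaming (classes to classes₂; class to class₂; class-++ to class-++₂)
  unionClasses (φ ⊔ ψ) = record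
    { classes  = classes₁ + classes₂
    ; class    = λ F T h → join classes₁ classes₂ (class⊎ F T h)
    ; class-++ = λ F T₁ T₂ h₁ h₂ e → class⊎-++ F T₁ T₂ h₁ h₂ (join-injective e)
    }
    where
    open UnionClasses (unionClasses φ) renaming (classes to classes₁; class to class₁; class-++ to class-++₁)
    open UnionClasses (unionClasses ψ) renaming (classes to classes₂; class to class₂; class-++ to class-++₂)
    class⊎ : ∀ F T → sat σ F T (φ ⊔ ψ) → Fin classes₁ ⊎ Fin classes₂
    class⊎ F T (inj₁ h) = inj₁ (class₁ F T h)
    class⊎ F T (inj₂ h) = inj₂ (class₂ F T h)
    class⊎-++ : ∀ F T₁ T₂ (h₁ : sat σ F T₁ (φ ⊔ ψ)) (h₂ : sat σ F T₂ (φ ⊔ ψ)) →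
                class⊎ F T₁ h₁ ≡ class⊎ F T₂ h₂ → sat σ F (T₁ ++ T₂) (φ ⊔ ψ)
    class⊎-++ F T₁ T₂ (inj₁ h₁) (inj₁ h₂) e = inj₁ (class-++₁ F T₁ T₂ h₁ h₂ (Sum.inj₁-injective e))
    class⊎-++ F T₁ T₂ (inj₂ h₁) (inj₂ h₂) e = inj₂ (class-++₂ F T₁ T₂ h₁ h₂ (Sum.inj₂-injective e))
  unionClasses (α ⊃ᵖ φ) = record
    { classes  = classes
    ; class    = λ F T → class F (restrict σ F T α)
    ; class-++ = λ F T₁ T₂ h₁ h₂ e →
        subst (λ T → sat σ F T φ) (sym (restrict-++ F T₁ T₂ α)) (class-++ F _ _ h₁ h₂ e)
    }
    where open UnionClasses (unionClasses φ)
  unionClasses (I □→ᵖ φ) = record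
    { classes  = classes
    ; class    = λ F T → class (intF σ F I) (map (intA σ F I) T)
    ; class-++ = λ F T₁ T₂ h₁ h₂ e →
        subst (λ T → sat σ (intF σ F I) T φ) (sym (List.map-++ (intA σ F I) T₁ T₂)) (class-++ _ _ _ h₁ h₂ e)
    }
    where open UnionClasses (unionClasses φ)

  sat-pairwise-union : ∀ φ F (T : ℕ → List (Asg σ)) → (∀ s → sat σ F (T s) φ) →
                       ∃₂ λ s t → s < t × sat σ F (T s ++ T t) φ
  sat-pairwise-union φ F T sat-T = pick (Fin.pigeonhole (ℕ.n<1+n classes) classOf)
    where
    open UnionClasses (unionClasses φ)
    classOf : Fin (suc classes) → Fin classes
    classOf i = class F (T (toℕ i)) (sat-T (toℕ i))
    pick : ∃₂ (λ i j → i Fin.< j × classOf i ≡ classOf j) → ∃₂ λ s t → s < t × sat σ F (T s ++ T t) φ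
    pick (i , j , i<j , same) = toℕ i , toℕ j , i<j , class-++ F _ _ _ _ same

  noEquations : RawFC σ
  noEquations = record { endo = λ _ → false ; fn = λ v s → s v }

  exogenous : List (Asg σ) → CausalMultiteam σ
  exogenous T = record
    { F = noEquations
    ; pa = λ _ _ → false ; dep = λ _ _ _ () ; rank = λ _ → 0 ; acyc = λ _ _ ()
    ; team = T ; compat = All.tabulate λ _ _ () }

  ¬ExpressiblePCO-of-unions : ∀ (A : CausalMultiteam σ → Set) (T : ℕ → List (Asg σ)) →
    (∀ s → A (exogenous (T s))) → (∀ s t → s < t → ¬ A (exogenous (T s ++ T t))) → ¬ ExpressiblePCO σ A
  ¬ExpressiblePCO-of-unions A T A-T ¬A-++ (φ , φ⇔A) =
    let s , t , s<t , sat-++ = sat-pairwise-union φ noEquations T (λ s → proj₂ (φ⇔A _) (A-T s))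
    in ¬A-++ s t s<t (proj₁ (φ⇔A _) sat-++)

  ExpressiblePCO-resp-⇔ : ∀ {A B : CausalMultiteam σ → Set} → (∀ T → A T ⇔ B T) →
                          ExpressiblePCO σ A → ExpressiblePCO σ B
  ExpressiblePCO-resp-⇔ A⇔B (φ , φ⇔A) =
    φ , λ T → to (A⇔B T) ∘ proj₁ (φ⇔A T) , proj₂ (φ⇔A T) ∘ from (A⇔B T)
    where open Equivalence

  CondAtom⇔UncondAtom : ∀ c α β γ δ → (∀ F s → satCO σ F s δ ≡ true) →
                        ∀ T → CondAtom σ c α β γ δ T ⇔ UncondAtom σ c α β γ T
  CondAtom⇔UncondAtom c α β γ δ valid T = mk⇔ (subst Atom T^δ≡T) (subst Atom (sym T^δ≡T))
    where
    T^δ≡T : restrict σ (F T) (team T) δ ≡ team T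
    T^δ≡T = List.filter-all (T? ∘ λ s → satCO σ (F T) s δ)
                            (All.universal (λ s → Equivalence.from T-≡ (valid (F T) s)) (team T))
    Atom : List (Asg σ) → Set
    Atom T′ = restrict σ (F T) (team T) β ≡ [] ⊎ T′ ≡ [] ⊎
              cmpℚ c (Pr σ (F T) (restrict σ (F T) (team T) β) α) (Pr σ (F T) T′ γ)

  UncondAtom⇔cross : ∀ c α β γ T {m n} →
    length (restrict σ (F T) (team T) β) ≡ suc m → length (team T) ≡ suc n →
    UncondAtom σ c α β γ T ⇔
      cmpℕ c (count (F T) (restrict σ (F T) (team T) β) α * suc n) (count (F T) (team T) γ * suc m)
  UncondAtom⇔cross c α β γ T {m} {n} |T^β| |T| = mk⇔ to from
    where
    open Equivalence (prop-cmp-prop⇔ c (count (F T) (restrict σ (F T) (team T) β) α) m (count (F T) (team T) γ) n)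
      renaming (to to cross; from to uncross)
    Cross : Set
    Cross = cmpℕ c (count (F T) (restrict σ (F T) (team T) β) α * suc n) (count (F T) (team T) γ * suc m)
    nonempty : ∀ {T′ : List (Asg σ)} {k} → length T′ ≡ suc k → T′ ≡ [] → ⊥
    nonempty |T′| refl = contradiction |T′| λ ()
    to : UncondAtom σ c α β γ T → Cross
    to (inj₁ T^β≡[])        = contradiction T^β≡[] (nonempty |T^β|)
    to (inj₂ (inj₁ T≡[]))   = contradiction T≡[] (nonempty |T|)
    to (inj₂ (inj₂ Pr◁Pr)) = cross (subst₂ (cmpℚ c) (cong (prop _) |T^β|) (cong (prop _) |T|) Pr◁Pr)
    from : Cross → UncondAtom σ c α β γ T
    from h = inj₂ (inj₂ (subst₂ (cmpℚ c) (cong (prop _) (sym |T^β|)) (cong (prop _) (sym |T|)) (uncross h)))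

  UncondAtom-complement : ∀ c v x β w y T →
    UncondAtom σ (converse c) (neqᶜ v x) β (neqᶜ w y) T ⇔ UncondAtom σ c (eqᶜ v x) β (eqᶜ w y) T
  UncondAtom-complement c v x β w y T with []-or-length-suc (restrict σ (F T) (team T) β)
  ... | inj₁ T^β≡[]     = mk⇔ (λ _ → inj₁ T^β≡[]) (λ _ → inj₁ T^β≡[])
  ... | inj₂ (m , |T^β|) with length-suc (team T) (subst (ℕ._≤ length (team T)) |T^β| (List.length-filter _ (team T)))
  ... | n , |T| =
    ⇔-trans (UncondAtom⇔cross (converse c) (neqᶜ v x) β (neqᶜ w y) T |T^β| |T|)
      (⇔-trans (⇔-sym (cmpℕ-converse c sums)) (⇔-sym (UncondAtom⇔cross c (eqᶜ v x) β (eqᶜ w y) T |T^β| |T|)))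
    where
    T^β : List (Asg σ)
    T^β = restrict σ (F T) (team T) β
    sums : count (F T) T^β (eqᶜ v x) * suc n + count (F T) T^β (neqᶜ v x) * suc n
         ≡ count (F T) (team T) (eqᶜ w y) * suc m + count (F T) (team T) (neqᶜ w y) * suc m
    sums = *-sum-swap (count (F T) T^β (eqᶜ v x)) (count (F T) T^β (neqᶜ v x))
                      (count (F T) (team T) (eqᶜ w y)) (count (F T) (team T) (neqᶜ w y))
                      (trans (count-eq+count-neq (F T) T^β v x) |T^β|)
                      (trans (count-eq+count-neq (F T) (team T) w y) |T|)

  ¬ExpressiblePCO-UncondAtom-converse : ∀ c v x β w y →
    ¬ ExpressiblePCO σ (UncondAtom σ c (eqᶜ v x) β (eqᶜ w y)) →
    ¬ ExpressiblePCO σ (UncondAtom σ (converse c) (neqᶜ v x) β (neqᶜ w y))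
  ¬ExpressiblePCO-UncondAtom-converse c v x β w y ¬expressible =
    ¬expressible ∘ ExpressiblePCO-resp-⇔ (UncondAtom-complement c v x β w y)

  ¬ExpressiblePCO-CondAtom : ∀ c α β γ δ → (∀ F s → satCO σ F s δ ≡ true) →
    ¬ ExpressiblePCO σ (UncondAtom σ c α β γ) → ¬ ExpressiblePCO σ (CondAtom σ c α β γ δ)
  ¬ExpressiblePCO-CondAtom c α β γ δ valid ¬expressible =
    ¬expressible ∘ ExpressiblePCO-resp-⇔ (CondAtom⇔UncondAtom c α β γ δ valid)

-- Counterexamples over one ternary variable

ternary : Signature
ternary = record { size = 1 ; rng = λ _ → 3 ; rng≥2 = λ _ → s≤s (s≤s z≤n) }

X : Var ternary
X = 0F

X≡0 X≡1 X≢0 X≢1 X≢2 ⊤ᶜ : CO ternary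
X≡0 = eqᶜ X 0F
X≡1 = eqᶜ X 1F
X≢0 = neqᶜ X 0F
X≢1 = neqᶜ X 1F
X≢2 = neqᶜ X 2F
⊤ᶜ  = eqᶜ X 0F ∨ᶜ neqᶜ X 0F

⊤ᶜ-valid : ∀ F s → satCO ternary F s ⊤ᶜ ≡ true
⊤ᶜ-valid F s = ∨-inverseʳ ⌊ s X ≟F 0F ⌋

-- Literals ignore the function component, so any choice of it gives the same count.
#⟨_⟩ : Fin 3 → List (Asg ternary) → ℕ
#⟨ x ⟩ T = count {ternary} noEquations T (eqᶜ X x)

length-restrict-X≢2 : ∀ F T → length (restrict ternary F T X≢2) ≡ #⟨ 0F ⟩ T + #⟨ 1F ⟩ T
length-restrict-X≢2 F []      = refl
length-restrict-X≢2 F (s ∷ T) with s X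
... | 0F = cong suc (length-restrict-X≢2 F T)
... | 1F = trans (cong suc (length-restrict-X≢2 F T)) (sym (ℕ.+-suc _ _))
... | 2F = length-restrict-X≢2 F T

count-X≡0-restrict-X≢2 : ∀ F T → count F (restrict ternary F T X≢2) X≡0 ≡ #⟨ 0F ⟩ T
count-X≡0-restrict-X≢2 F []      = refl
count-X≡0-restrict-X≢2 F (s ∷ T) with s X in sX
... | 0F rewrite sX = cong suc (count-X≡0-restrict-X≢2 F T)
... | 1F rewrite sX = count-X≡0-restrict-X≢2 F T
... | 2F = count-X≡0-restrict-X≢2 F T

length≡#0+#1+#2 : ∀ T → length T ≡ #⟨ 0F ⟩ T + #⟨ 1F ⟩ T + #⟨ 2F ⟩ T
length≡#0+#1+#2 []      = refl
length≡#0+#1+#2 (s ∷ T) with s X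
... | 0F = cong suc (length≡#0+#1+#2 T)
... | 1F = trans (cong suc (length≡#0+#1+#2 T)) (sym (cong (_+ #⟨ 2F ⟩ T) (ℕ.+-suc (#⟨ 0F ⟩ T) (#⟨ 1F ⟩ T))))
... | 2F = trans (cong suc (length≡#0+#1+#2 T)) (sym (ℕ.+-suc _ _))

record HasTally (T : List (Asg ternary)) (a b k : ℕ) : Set where
  constructor tally
  field
    #0≡ : #⟨ 0F ⟩ T ≡ a
    #1≡ : #⟨ 1F ⟩ T ≡ b
    #2≡ : #⟨ 2F ⟩ T ≡ k

-- On a team with 1 + a zeros, b ones and k twos, Pr(X=0 | X≠2) = (1 + a)/(1 + a + b)
-- and Pr(X=1) = b/(1 + a + b + k); these are their cross-multiplied numerators.
cross₀ : ℕ → ℕ → ℕ → ℕ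
cross₀ a b k = suc a * suc (a + b + k)

cross₁ : ℕ → ℕ → ℕ
cross₁ a b = b * suc (a + b)

UncondAtom⇔tally : ∀ c T {a b k} → HasTally (team T) (suc a) b k →
  UncondAtom ternary c X≡0 X≢2 X≡1 T ⇔ cmpℕ c (cross₀ a b k) (cross₁ a b)
UncondAtom⇔tally c T {a} {b} {k} (tally #0 #1 #2) =
  subst (λ P → UncondAtom ternary c X≡0 X≢2 X≡1 T ⇔ P)
        (cong₂ (λ n₀ n₁ → cmpℕ c (n₀ * suc (a + b + k)) (n₁ * suc (a + b)))
               (trans (count-X≡0-restrict-X≢2 (F T) (team T)) #0) #1)
        (UncondAtom⇔cross c X≡0 X≢2 X≡1 T |T^X≢2| |T|)
  where
  |T^X≢2| : length (restrict ternary (F T) (team T) X≢2) ≡ suc (a + b)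
  |T^X≢2| = trans (length-restrict-X≢2 (F T) (team T)) (cong₂ _+_ #0 #1)
  |T| : length (team T) ≡ suc (a + b + k)
  |T| = trans (length≡#0+#1+#2 (team T)) (cong₂ _+_ (cong₂ _+_ #0 #1) #2)

HasTally-++ : ∀ {T₁ T₂ a b k a′ b′ k′} → HasTally T₁ a b k → HasTally T₂ a′ b′ k′ →
              HasTally (T₁ ++ T₂) (a + a′) (b + b′) (k + k′)
HasTally-++ {T₁} {T₂} (tally #0 #1 #2) (tally #0′ #1′ #2′) =
  tally (trans (#-++ 0F) (cong₂ _+_ #0 #0′))
        (trans (#-++ 1F) (cong₂ _+_ #1 #1′))
        (trans (#-++ 2F) (cong₂ _+_ #2 #2′))
  where
  #-++ : ∀ x → #⟨ x ⟩ (T₁ ++ T₂) ≡ #⟨ x ⟩ T₁ + #⟨ x ⟩ T₂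
  #-++ x = count-++ {ternary} noEquations T₁ T₂ (eqᶜ X x)

length-filterᵇ-replicate : ∀ {A : Set} (p : A → Bool) n x →
                           length (filterᵇ p (replicate n x)) ≡ (if p x then n else 0)
length-filterᵇ-replicate p zero    x with p x
... | true  = refl
... | false = refl
length-filterᵇ-replicate p (suc n) x with p x | length-filterᵇ-replicate p n x
... | true  | ih = cong suc ih
... | false | ih = ih

constant : Fin 3 → Asg ternary
constant x _ = x

HasTally-replicate : ∀ x n → HasTally (replicate n (constant x))
  (if ⌊ x ≟F 0F ⌋ then n else 0) (if ⌊ x ≟F 1F ⌋ then n else 0) (if ⌊ x ≟F 2F ⌋ then n else 0)
HasTally-replicate x n = tally (#-replicate 0F) (#-replicate 1F) (#-replicate 2F)
  where
  #-replicate : ∀ y → #⟨ y ⟩ (replicate n (constant x)) ≡ (if ⌊ x ≟F y ⌋ then n else 0)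
  #-replicate y = length-filterᵇ-replicate (λ s → ⌊ s X ≟F y ⌋) n (constant x)

tallied : ℕ → ℕ → ℕ → List (Asg ternary)
tallied a b k = replicate a (constant 0F) ++ replicate b (constant 1F) ++ replicate k (constant 2F)

HasTally-tallied : ∀ a b k → HasTally (tallied a b k) a b k
HasTally-tallied a b k
  with tally #0 #1 #2 ← HasTally-++ (HasTally-replicate 0F a) (HasTally-++ (HasTally-replicate 1F b) (HasTally-replicate 2F k))
  = tally (trans #0 (ℕ.+-identityʳ a)) (trans #1 (ℕ.+-identityʳ b)) #2

ones : ℕ → ℕ
ones s = 2 * suc s

-- twos e s + 2 ≡ ones s * ones s + e
twos : ℕ → ℕ → ℕ
twos e s = e + (4 * (s * s) + 8 * s + 2)

family : ℕ → ℕ → List (Asg ternary)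
family e s = tallied 1 (ones s) (twos e s)

family-cross : ∀ e s → suc (cross₀ 0 (ones s) (twos e s)) ≡ e + cross₁ 0 (ones s)
family-cross = identity
  where
  identity : ∀ e s → suc (1 * suc (2 * suc s + (e + (4 * (s * s) + 8 * s + 2)))) ≡ e + 2 * suc s * suc (2 * suc s)
  identity = solve-∀

-- The excess of a union is 4e plus (ones t − ones s)² − 4.
family-++-cross : ∀ e {s t} → s < t → ∃ λ x →
  cross₀ 1 (ones s + ones t) (twos e s + twos e t) ≡ 4 * e + x + cross₁ 1 (ones s + ones t)
family-++-cross e {s} s<t with o , refl ← ℕ.m≤n⇒∃[o]m+o≡n s<t = 4 * (o * (o + 2)) , identity e s o
  where
  identity : ∀ e s o → let t = suc s + o
                           B = 2 * suc s + 2 * suc t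
                           K = (e + (4 * (s * s) + 8 * s + 2)) + (e + (4 * (t * t) + 8 * t + 2)) in
             2 * suc (1 + B + K) ≡ 4 * e + 4 * (o * (o + 2)) + B * suc (1 + B)
  identity = solve-∀

family₁-balanced : ∀ s → cross₀ 0 (ones s) (twos 1 s) ≡ cross₁ 0 (ones s)
family₁-balanced s = ℕ.suc-injective (family-cross 1 s)

family₁-++-heavy : ∀ {s t} → s < t →
  cross₁ 1 (ones s + ones t) < cross₀ 1 (ones s + ones t) (twos 1 s + twos 1 t)
family₁-++-heavy {s} {t} s<t with x , excess ← family-++-cross 1 s<t =
  subst (cross₁ 1 (ones s + ones t) <_) (sym excess) (ℕ.m<n+m _ {4 + x} (s≤s z≤n))

family₀-light : ∀ s → cross₀ 0 (ones s) (twos 0 s) < cross₁ 0 (ones s)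
family₀-light s = ℕ.≤-reflexive (family-cross 0 s)

family₀-++-not-light : ∀ {s t} → s < t →
  cross₁ 1 (ones s + ones t) ℕ.≤ cross₀ 1 (ones s + ones t) (twos 0 s + twos 0 t)
family₀-++-not-light {s} {t} s<t with x , excess ← family-++-cross 0 s<t =
  subst (cross₁ 1 (ones s + ones t) ℕ.≤_) (sym excess) (ℕ.m≤n+m (cross₁ 1 (ones s + ones t)) x)

HasTally-family : ∀ e s → HasTally (family e s) 1 (ones s) (twos e s)
HasTally-family e s = HasTally-tallied 1 (ones s) (twos e s)

¬ExpressiblePCO-family : ∀ c e →
  (∀ s → cmpℕ c (cross₀ 0 (ones s) (twos e s)) (cross₁ 0 (ones s))) →
  (∀ {s t} → s < t → ¬ cmpℕ c (cross₀ 1 (ones s + ones t) (twos e s + twos e t)) (cross₁ 1 (ones s + ones t))) →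
  ¬ ExpressiblePCO ternary (UncondAtom ternary c X≡0 X≢2 X≡1)
¬ExpressiblePCO-family c e single ¬union = ¬ExpressiblePCO-of-unions _ (family e)
  (λ s → from (UncondAtom⇔tally c (exogenous (family e s)) (HasTally-family e s)) (single s))
  (λ s t s<t → ¬union s<t ∘ to (UncondAtom⇔tally c (exogenous (family e s ++ family e t))
                                  (HasTally-++ (HasTally-family e s) (HasTally-family e t))))
  where open Equivalence

le-inexpressible : ¬ ExpressiblePCO ternary (UncondAtom ternary le X≡0 X≢2 X≡1)
le-inexpressible = ¬ExpressiblePCO-family le 1 (ℕ.≤-reflexive ∘ family₁-balanced) (ℕ.<⇒≱ ∘ family₁-++-heavy)

eq-inexpressible : ¬ ExpressiblePCO ternary (UncondAtom ternary eq X≡0 X≢2 X≡1)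
eq-inexpressible = ¬ExpressiblePCO-family eq 1 family₁-balanced (λ s<t → ℕ.<⇒≢ (family₁-++-heavy s<t) ∘ sym)

lt-inexpressible : ¬ ExpressiblePCO ternary (UncondAtom ternary lt X≡0 X≢2 X≡1)
lt-inexpressible = ¬ExpressiblePCO-family lt 0 family₀-light (ℕ.≤⇒≯ ∘ family₀-++-not-light)

unconditional : ∀ c → Σ (CO ternary) λ α → Σ (CO ternary) λ γ →
                ¬ ExpressiblePCO ternary (UncondAtom ternary c α X≢2 γ)
unconditional le = X≡0 , X≡1 , le-inexpressible
unconditional eq = X≡0 , X≡1 , eq-inexpressible
unconditional lt = X≡0 , X≡1 , lt-inexpressible
unconditional ge = X≢0 , X≢1 , ¬ExpressiblePCO-UncondAtom-converse le X 0F X≢2 X 1F le-inexpressible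
unconditional gt = X≢0 , X≢1 , ¬ExpressiblePCO-UncondAtom-converse lt X 0F X≢2 X 1F lt-inexpressible

theorem8 : (c : Cmp) →
    (Σ Signature λ σ → Σ (CO σ) λ α → Σ (CO σ) λ β → Σ (CO σ) λ γ → Σ (CO σ) λ δ →
    ¬ ExpressiblePCO σ (CondAtom σ c α β γ δ))
    × (Σ Signature λ σ → Σ (CO σ) λ α → Σ (CO σ) λ β → Σ (CO σ) λ γ →
    ¬ ExpressiblePCO σ (UncondAtom σ c α β γ))
theorem8 c with α , γ , ¬expressible ← unconditional c =
  (ternary , α , X≢2 , γ , ⊤ᶜ , ¬ExpressiblePCO-CondAtom c α X≢2 γ ⊤ᶜ ⊤ᶜ-valid ¬expressible) ,
  (ternary , α , X≢2 , γ , ¬expressible)
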